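{- In $\mathbf{IPF}^I$, for every formula $F$ and distinct variables $x,y$ ($y$ not occurring in $F$): $\exists y\forall x(F\leftrightarrow x=y)\vdash Ix[F,\exists!x]$.
   Context: $\mathbf{IPF}$ is a natural deduction system of intuitionist positive free logic: a first-order language without function symbols, terms constants and parameters, primitive predicate $\exists!$ ("exists"), identity; standard intuitionist rules for $\land,\rightarrow,\lor,\leftrightarrow$, $\bot E$ to atomic conclusions; $\forall I$ (infer $\forall xA$ from a deduction of $A^x_a$, discharging $\exists!a$, $a$ fresh), $\forall E$ (from $\forall xA$, $\exists!t$ infer $A^x_t$), $\exists I$ (from $A^x_t$, $\exists!t$ infer $\exists xA$), $\exists E$ (from $\exists xA$ and a deduction of $C$ from $A^x_a,\exists!a$ infer $C$, discharging them, $a$ fresh); $=I$: axiom $t=t$; $=E$: from $t_1=t_2$ and $A^x_{t_1}$ infer $A^x_{t_2}$ ($A$ atomic). $\mathbf{IPF}^I$ adds formulas $Ix[F,G]$ ("the $F$ is $G$", binding $x$) with rules ($a,b$ fresh parameters not occurring in $F,G,C$ or other open assumptions of the subdeduction, $a\neq t$): $II$: from $F^x_t,G^x_t,\exists!t$ and a deduction of $a=t$ from $F^x_a,\exists!a$ (discharged) infer $Ix[F,G]$; $IE^{1p}$: from $Ix[F,G]$, $F^x_t$, $\exists!t$, a deduction of $a=t$ from $F^x_a,\exists!a$ and a deduction of $C$ from $F^x_b,G^x_b,\exists!b$ (all discharged) infer $C$; $IE^{2p}$: from $Ix[F,\exists!x],\exists!t_1,\exists!t_2,F^x_{t_1},F^x_{t_2},A^x_{t_1}$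 infer $A^x_{t_2}$ ($A$ atomic); $IE^{3p}$: from $Ix[F,\exists!x]$ and a deduction of $C$ from $F^x_a,\exists!a$ (discharged) infer $C$; $IE^{4p}$: from $Ix[F,x=t_2],\exists!t_1,\exists!t_2,F^x_{t_1},A^x_{t_1}$ infer $A^x_{t_2}$ ($A$ atomic); $IE^{5p}$: from $Ix[F,x=t],\exists!t$ and a deduction of $C$ from $F^x_a,\exists!a$ (discharged) infer $C$. -}

module Defs where

open import Data.Nat using (ℕ; _≟_)
open import Data.Bool using (Bool; true; false; _∨_; if_then_else_)
open import Data.List using (List; []; _∷_; map)
open import Data.Bool.ListAction using (any)
open import Data.List.Membership.Propositional using (_∈_)
open import Data.List.Relation.Unary.All using (All)
open import Relation.Nullary using (¬_; yes; no; does)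
open import Relation.Binary.PropositionalEquality using (_≡_; _≢_)

Var : Set
Var = ℕ

Par : Set
Par = ℕ

Const : Set
Const = ℕ

PredSym : Set
PredSym = ℕ

-- Terms proper of the language: constants and parameters.
data CTerm : Set where
  par : Par → CTerm
  con : Const → CTerm

-- Argument positions of atomic formulas may also hold (bound) variables.
data Term : Set where
  var : Var → Term
  ⌜_⌝ : CTerm → Term

infix  8 _≐_
infixr 6 _∧'_
infixr 5 _∨'_
infixr 4 _⇒_
infix  3 _⇔_

data Formula : Set where
  pred  : PredSym → List Term → Formula
  E!    : Term → Formula                  -- ∃! t  ("t exists")
  _≐_   : Term → Term → Formula
  ⊥'    : Formula
  _∧'_  : Formula → Formula → Formula
  _⇒_   : Formula → Formula → Formula
  _∨'_  : Formula → Formula → Formula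
  _⇔_   : Formula → Formula → Formula
  ∀'    : Var → Formula → Formula
  ∃'    : Var → Formula → Formula
  ι     : Var → Formula → Formula → Formula   -- ι x F G  =  Ix[F,G], binds x in F and G

data Atomic : Formula → Set where
  atP  : ∀ P ts → Atomic (pred P ts)
  atE  : ∀ t → Atomic (E! t)
  atEq : ∀ s t → Atomic (s ≐ t)

-- Substitution A^x_t of a (closed) term t for the free occurrences of x.
-- Since t contains no variables, no capture can occur.

substT : Var → CTerm → Term → Term
substT x t (var y) with does (x ≟ y)
... | true  = ⌜ t ⌝
... | false = var y
substT x t ⌜ c ⌝ = ⌜ c ⌝

_[_≔_] : Formula → Var → CTerm → Formula
pred P ts [ x ≔ t ] = pred P (map (substT x t) ts)
E! s      [ x ≔ t ] = E! (substT x t s)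
(s ≐ u)   [ x ≔ t ] = substT x t s ≐ substT x t u
⊥'        [ x ≔ t ] = ⊥'
(A ∧' B)  [ x ≔ t ] = (A [ x ≔ t ]) ∧' (B [ x ≔ t ])
(A ⇒ B)   [ x ≔ t ] = (A [ x ≔ t ]) ⇒ (B [ x ≔ t ])
(A ∨' B)  [ x ≔ t ] = (A [ x ≔ t ]) ∨' (B [ x ≔ t ])
(A ⇔ B)   [ x ≔ t ] = (A [ x ≔ t ]) ⇔ (B [ x ≔ t ])
∀' y A    [ x ≔ t ] = if does (x ≟ y) then ∀' y A else ∀' y (A [ x ≔ t ])
∃' y A    [ x ≔ t ] = if does (x ≟ y) then ∃' y A else ∃' y (A [ x ≔ t ])
ι y F G   [ x ≔ t ] = if does (x ≟ y) then ι y F G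
                      else ι y (F [ x ≔ t ]) (G [ x ≔ t ])

parInT : Par → Term → Bool
parInT a (var _)       = false
parInT a ⌜ par b ⌝     = does (a ≟ b)
parInT a ⌜ con _ ⌝     = false

parIn : Par → Formula → Bool
parIn a (pred P ts) = any (parInT a) ts
parIn a (E! t)      = parInT a t
parIn a (s ≐ t)     = parInT a s ∨ parInT a t
parIn a ⊥'          = false
parIn a (A ∧' B)    = parIn a A ∨ parIn a B
parIn a (A ⇒ B)     = parIn a A ∨ parIn a B
parIn a (A ∨' B)    = parIn a A ∨ parIn a B
parIn a (A ⇔ B)     = parIn a A ∨ parIn a B
parIn a (∀' _ A)    = parIn a A
parIn a (∃' _ A)    = parIn a A
parIn a (ι _ F G)   = parIn a F ∨ parIn a G

_#_ : Par → Formula → Set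
a # A = parIn a A ≡ false

_#*_ : Par → List Formula → Set
a #* Γ = All (a #_) Γ

_#ₜ_ : Par → CTerm → Set
a #ₜ t = par a ≢ t

varInT : Var → Term → Bool
varInT y (var z) = does (y ≟ z)
varInT y ⌜ _ ⌝   = false

varIn : Var → Formula → Bool
varIn y (pred P ts) = any (varInT y) ts
varIn y (E! t)      = varInT y t
varIn y (s ≐ t)     = varInT y s ∨ varInT y t
varIn y ⊥'          = false
varIn y (A ∧' B)    = varIn y A ∨ varIn y B
varIn y (A ⇒ B)     = varIn y A ∨ varIn y B
varIn y (A ∨' B)    = varIn y A ∨ varIn y B
varIn y (A ⇔ B)     = varIn y A ∨ varIn y B
varIn y (∀' z A)    = does (y ≟ z) ∨ varIn y A
varIn y (∃' z A)    = does (y ≟ z) ∨ varIn y A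
varIn y (ι z F G)   = does (y ≟ z) ∨ varIn y F ∨ varIn y G

-- Natural deduction system IPF^I, in sequent-style presentation:
-- Γ ⊢ A  means: there is a deduction of A whose open assumptions are
-- among Γ.  Discharging an assumption = removing it from the context.

infix 2 _⊢_

data _⊢_ (Γ : List Formula) : Formula → Set where
  hyp  : ∀ {A} → A ∈ Γ → Γ ⊢ A
  ∧I   : ∀ {A B} → Γ ⊢ A → Γ ⊢ B → Γ ⊢ A ∧' B
  ∧E₁  : ∀ {A B} → Γ ⊢ A ∧' B → Γ ⊢ A
  ∧E₂  : ∀ {A B} → Γ ⊢ A ∧' B → Γ ⊢ B
  ⇒I   : ∀ {A B} → A ∷ Γ ⊢ B → Γ ⊢ A ⇒ B
  ⇒E   : ∀ {A B} → Γ ⊢ A ⇒ B → Γ ⊢ A → Γ ⊢ B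
  ∨I₁  : ∀ {A B} → Γ ⊢ A → Γ ⊢ A ∨' B
  ∨I₂  : ∀ {A B} → Γ ⊢ B → Γ ⊢ A ∨' B
  ∨E   : ∀ {A B C} → Γ ⊢ A ∨' B → A ∷ Γ ⊢ C → B ∷ Γ ⊢ C → Γ ⊢ C
  ⇔I   : ∀ {A B} → A ∷ Γ ⊢ B → B ∷ Γ ⊢ A → Γ ⊢ A ⇔ B
  ⇔E₁  : ∀ {A B} → Γ ⊢ A ⇔ B → Γ ⊢ A → Γ ⊢ B
  ⇔E₂  : ∀ {A B} → Γ ⊢ A ⇔ B → Γ ⊢ B → Γ ⊢ A
  ⊥E   : ∀ {A} → Atomic A → Γ ⊢ ⊥' → Γ ⊢ A
  ∀I   : ∀ {x A} (a : Par) → a # ∀' x A → a #* Γ →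
         E! ⌜ par a ⌝ ∷ Γ ⊢ A [ x ≔ par a ] → Γ ⊢ ∀' x A
  ∀E   : ∀ {x A} (t : CTerm) → Γ ⊢ ∀' x A → Γ ⊢ E! ⌜ t ⌝ → Γ ⊢ A [ x ≔ t ]
  ∃I   : ∀ {x A} (t : CTerm) → Γ ⊢ A [ x ≔ t ] → Γ ⊢ E! ⌜ t ⌝ → Γ ⊢ ∃' x A
  ∃E   : ∀ {x A C} (a : Par) → a # ∃' x A → a # C → a #* Γ →
         Γ ⊢ ∃' x A → A [ x ≔ par a ] ∷ E! ⌜ par a ⌝ ∷ Γ ⊢ C → Γ ⊢ C
  =I   : ∀ (t : CTerm) → Γ ⊢ ⌜ t ⌝ ≐ ⌜ t ⌝
  =E   : ∀ {x A} (t₁ t₂ : CTerm) → Atomic A →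
         Γ ⊢ ⌜ t₁ ⌝ ≐ ⌜ t₂ ⌝ → Γ ⊢ A [ x ≔ t₁ ] → Γ ⊢ A [ x ≔ t₂ ]
  II   : ∀ {x F G} (t : CTerm) (a : Par) → a # F → a # G → a #* Γ → a #ₜ t →
         Γ ⊢ F [ x ≔ t ] → Γ ⊢ G [ x ≔ t ] → Γ ⊢ E! ⌜ t ⌝ →
         F [ x ≔ par a ] ∷ E! ⌜ par a ⌝ ∷ Γ ⊢ ⌜ par a ⌝ ≐ ⌜ t ⌝ →
         Γ ⊢ ι x F G
  IE1p : ∀ {x F G C} (t : CTerm) (a b : Par) →
         a # F → a # G → a # C → a #* Γ → a #ₜ t →
         b # F → b # G → b # C → b #* Γ →
         Γ ⊢ ι x F G → Γ ⊢ F [ x ≔ t ] → Γ ⊢ E! ⌜ t ⌝ →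
         F [ x ≔ par a ] ∷ E! ⌜ par a ⌝ ∷ Γ ⊢ ⌜ par a ⌝ ≐ ⌜ t ⌝ →
         F [ x ≔ par b ] ∷ G [ x ≔ par b ] ∷ E! ⌜ par b ⌝ ∷ Γ ⊢ C →
         Γ ⊢ C
  IE2p : ∀ {x F A} (t₁ t₂ : CTerm) → Atomic A →
         Γ ⊢ ι x F (E! (var x)) → Γ ⊢ E! ⌜ t₁ ⌝ → Γ ⊢ E! ⌜ t₂ ⌝ →
         Γ ⊢ F [ x ≔ t₁ ] → Γ ⊢ F [ x ≔ t₂ ] → Γ ⊢ A [ x ≔ t₁ ] →
         Γ ⊢ A [ x ≔ t₂ ]
  IE3p : ∀ {x F C} (a : Par) → a # F → a # C → a #* Γ →
         Γ ⊢ ι x F (E! (var x)) →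
         F [ x ≔ par a ] ∷ E! ⌜ par a ⌝ ∷ Γ ⊢ C → Γ ⊢ C
  IE4p : ∀ {x F A} (t₁ t₂ : CTerm) → Atomic A →
         Γ ⊢ ι x F (var x ≐ ⌜ t₂ ⌝) → Γ ⊢ E! ⌜ t₁ ⌝ → Γ ⊢ E! ⌜ t₂ ⌝ →
         Γ ⊢ F [ x ≔ t₁ ] → Γ ⊢ A [ x ≔ t₁ ] → Γ ⊢ A [ x ≔ t₂ ]
  IE5p : ∀ {x F C} (t : CTerm) (a : Par) →
         a # F → a # C → a #* Γ → a #ₜ t →
         Γ ⊢ ι x F (var x ≐ ⌜ t ⌝) → Γ ⊢ E! ⌜ t ⌝ →
         F [ x ≔ par a ] ∷ E! ⌜ par a ⌝ ∷ Γ ⊢ C → Γ ⊢ C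

{-# OPTIONS --safe #-}
module Submission where

-- Eliminating the hypothesis ∃y∀x(F ↔ x = y) yields a fresh b with ∃!b and
-- ∀x(F ↔ x = b).  Rule II then concludes Ix[F, ∃!x] with witness b: F(b)
-- holds because b = b, ∃!b is assumed, and any a with F(a), ∃!a satisfies
-- a = b by the same biconditional.

open import Defs
open import Data.Bool using (false; _∨_)
open import Data.Bool.ListAction using (any)
open import Data.Bool.Properties using (∨-conicalˡ; ∨-conicalʳ)
open import Data.List using (List; _∷_; []; map)
open import Data.List.Membership.Propositional using (_∈_)
open import Data.List.Relation.Unary.Any using (here; there)
open import Data.List.Relation.Unary.All using ([]; _∷_; head; tail; lookup)
open import Data.Nat using (ℕ; suc; _≟_; _⊔_; _<_)
open import Data.Nat.Properties using (<-irrefl; n<1+n; m⊔n<o⇒m<o; m⊔n<o⇒n<o)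
open import Function using (_∘_)
open import Relation.Nullary.Decidable using (does; dec-true; dec-false)
open import Relation.Binary.PropositionalEquality
  using (_≡_; _≢_; refl; sym; trans; cong; cong₂; subst)

substT-var-self : ∀ x t → substT x t (var x) ≡ ⌜ t ⌝
substT-var-self x t rewrite dec-true (x ≟ x) refl = refl

substT-notIn : ∀ y t s → varInT y s ≡ false → substT y t s ≡ s
substT-notIn y t (var z) y∉s rewrite y∉s = refl
substT-notIn y t ⌜ c ⌝   _   = refl

substTs-notIn : ∀ y t ts → any (varInT y) ts ≡ false → map (substT y t) ts ≡ ts
substTs-notIn y t []       _   = refl
substTs-notIn y t (s ∷ ts) y∉ =
  cong₂ _∷_ (substT-notIn y t s (∨-conicalˡ _ _ y∉))
            (substTs-notIn y t ts (∨-conicalʳ _ _ y∉))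

[≔]-notIn : ∀ y t A → varIn y A ≡ false → A [ y ≔ t ] ≡ A
[≔]-notIn y t (pred P ts) y∉ = cong (pred P) (substTs-notIn y t ts y∉)
[≔]-notIn y t (E! s)      y∉ = cong E! (substT-notIn y t s y∉)
[≔]-notIn y t (s ≐ u)     y∉ =
  cong₂ _≐_ (substT-notIn y t s (∨-conicalˡ _ _ y∉)) (substT-notIn y t u (∨-conicalʳ _ _ y∉))
[≔]-notIn y t ⊥'          _  = refl
[≔]-notIn y t (A ∧' B)    y∉ =
  cong₂ _∧'_ ([≔]-notIn y t A (∨-conicalˡ _ _ y∉)) ([≔]-notIn y t B (∨-conicalʳ _ _ y∉))
[≔]-notIn y t (A ⇒ B)     y∉ =
  cong₂ _⇒_ ([≔]-notIn y t A (∨-conicalˡ _ _ y∉)) ([≔]-notIn y t B (∨-conicalʳ _ _ y∉))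
[≔]-notIn y t (A ∨' B)    y∉ =
  cong₂ _∨'_ ([≔]-notIn y t A (∨-conicalˡ _ _ y∉)) ([≔]-notIn y t B (∨-conicalʳ _ _ y∉))
[≔]-notIn y t (A ⇔ B)     y∉ =
  cong₂ _⇔_ ([≔]-notIn y t A (∨-conicalˡ _ _ y∉)) ([≔]-notIn y t B (∨-conicalʳ _ _ y∉))
[≔]-notIn y t (∀' z A)    y∉ rewrite ∨-conicalˡ (does (y ≟ z)) _ y∉ =
  cong (∀' z) ([≔]-notIn y t A (∨-conicalʳ _ _ y∉))
[≔]-notIn y t (∃' z A)    y∉ rewrite ∨-conicalˡ (does (y ≟ z)) _ y∉ =
  cong (∃' z) ([≔]-notIn y t A (∨-conicalʳ _ _ y∉))
[≔]-notIn y t (ι z F G)   y∉ rewrite ∨-conicalˡ (does (y ≟ z)) _ y∉ =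
  cong₂ (ι z) ([≔]-notIn y t F (∨-conicalˡ _ _ y∉FG)) ([≔]-notIn y t G (∨-conicalʳ _ _ y∉FG))
  where
  y∉FG : varIn y F ∨ varIn y G ≡ false
  y∉FG = ∨-conicalʳ (does (y ≟ z)) _ y∉

[≔]-∀⇔≐ : ∀ {x y} F t → x ≢ y → varIn y F ≡ false →
           (∀' x (F ⇔ var x ≐ var y)) [ y ≔ t ] ≡ ∀' x (F ⇔ var x ≐ ⌜ t ⌝)
[≔]-∀⇔≐ {x} {y} F t x≢y y∉F
  rewrite dec-false (y ≟ x) (x≢y ∘ sym) | dec-true (y ≟ y) refl | [≔]-notIn y t F y∉F = refl

maxParᵀ : Term → ℕ
maxParᵀ (var _)   = 0
maxParᵀ ⌜ par b ⌝ = b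
maxParᵀ ⌜ con _ ⌝ = 0

maxParᵀs : List Term → ℕ
maxParᵀs []       = 0
maxParᵀs (t ∷ ts) = maxParᵀ t ⊔ maxParᵀs ts

maxPar : Formula → ℕ
maxPar (pred _ ts) = maxParᵀs ts
maxPar (E! t)      = maxParᵀ t
maxPar (s ≐ t)     = maxParᵀ s ⊔ maxParᵀ t
maxPar ⊥'          = 0
maxPar (A ∧' B)    = maxPar A ⊔ maxPar B
maxPar (A ⇒ B)     = maxPar A ⊔ maxPar B
maxPar (A ∨' B)    = maxPar A ⊔ maxPar B
maxPar (A ⇔ B)     = maxPar A ⊔ maxPar B
maxPar (∀' _ A)    = maxPar A
maxPar (∃' _ A)    = maxPar A
maxPar (ι _ F G)   = maxPar F ⊔ maxPar G

maxPar* : List Formula → ℕ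
maxPar* []      = 0
maxPar* (A ∷ Γ) = maxPar A ⊔ maxPar* Γ

maxParᵀ<⇒∉ : ∀ {a} t → maxParᵀ t < a → parInT a t ≡ false
maxParᵀ<⇒∉ (var _)   _ = refl
maxParᵀ<⇒∉ {a} ⌜ par b ⌝ b<a = dec-false (a ≟ b) λ { refl → <-irrefl refl b<a }
maxParᵀ<⇒∉ ⌜ con _ ⌝ _ = refl

maxParᵀs<⇒∉ : ∀ {a} ts → maxParᵀs ts < a → any (parInT a) ts ≡ false
maxParᵀs<⇒∉ []       _ = refl
maxParᵀs<⇒∉ (t ∷ ts) p =
  cong₂ _∨_ (maxParᵀ<⇒∉ t (m⊔n<o⇒m<o _ _ p)) (maxParᵀs<⇒∉ ts (m⊔n<o⇒n<o _ _ p))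

maxPar<⇒# : ∀ {a} A → maxPar A < a → a # A
maxPar<⇒# (pred _ ts) p = maxParᵀs<⇒∉ ts p
maxPar<⇒# (E! t)      p = maxParᵀ<⇒∉ t p
maxPar<⇒# (s ≐ t)     p = cong₂ _∨_ (maxParᵀ<⇒∉ s (m⊔n<o⇒m<o _ _ p)) (maxParᵀ<⇒∉ t (m⊔n<o⇒n<o _ _ p))
maxPar<⇒# ⊥'          _ = refl
maxPar<⇒# (A ∧' B)    p = cong₂ _∨_ (maxPar<⇒# A (m⊔n<o⇒m<o _ _ p)) (maxPar<⇒# B (m⊔n<o⇒n<o _ _ p))
maxPar<⇒# (A ⇒ B)     p = cong₂ _∨_ (maxPar<⇒# A (m⊔n<o⇒m<o _ _ p)) (maxPar<⇒# B (m⊔n<o⇒n<o _ _ p))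
maxPar<⇒# (A ∨' B)    p = cong₂ _∨_ (maxPar<⇒# A (m⊔n<o⇒m<o _ _ p)) (maxPar<⇒# B (m⊔n<o⇒n<o _ _ p))
maxPar<⇒# (A ⇔ B)     p = cong₂ _∨_ (maxPar<⇒# A (m⊔n<o⇒m<o _ _ p)) (maxPar<⇒# B (m⊔n<o⇒n<o _ _ p))
maxPar<⇒# (∀' _ A)    p = maxPar<⇒# A p
maxPar<⇒# (∃' _ A)    p = maxPar<⇒# A p
maxPar<⇒# (ι _ F G)   p = cong₂ _∨_ (maxPar<⇒# F (m⊔n<o⇒m<o _ _ p)) (maxPar<⇒# G (m⊔n<o⇒n<o _ _ p))

maxPar*<⇒#* : ∀ {a} Γ → maxPar* Γ < a → a #* Γ
maxPar*<⇒#* []      _ = []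
maxPar*<⇒#* (A ∷ Γ) p = maxPar<⇒# A (m⊔n<o⇒m<o _ _ p) ∷ maxPar*<⇒#* Γ (m⊔n<o⇒n<o _ _ p)

fresh : List Formula → Par
fresh Γ = suc (maxPar* Γ)

fresh-#* : ∀ Γ → fresh Γ #* Γ
fresh-#* Γ = maxPar*<⇒#* Γ (n<1+n _)

#E!⇒#ₜ : ∀ {a} t → a # E! ⌜ t ⌝ → a #ₜ t
#E!⇒#ₜ {a} (par .a) a∉ refl with () ← trans (sym (dec-true (a ≟ a) refl)) a∉

∀E-⇔≐ : ∀ {Γ x F} s t → Γ ⊢ ∀' x (F ⇔ var x ≐ ⌜ s ⌝) → Γ ⊢ E! ⌜ t ⌝ →
        Γ ⊢ F [ x ≔ t ] ⇔ ⌜ t ⌝ ≐ ⌜ s ⌝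
∀E-⇔≐ {Γ} {x} {F} s t H t↓ =
  subst (λ u → Γ ⊢ F [ x ≔ t ] ⇔ u ≐ ⌜ s ⌝) (substT-var-self x t) (∀E t H t↓)

uniqueWitness⇒ι : ∀ {Γ x F} t → ∀' x (F ⇔ var x ≐ ⌜ t ⌝) ∈ Γ → E! ⌜ t ⌝ ∈ Γ →
                  Γ ⊢ ι x F (E! (var x))
uniqueWitness⇒ι {Γ} {x} {F} t H∈Γ t↓∈Γ =
  II t a a#F refl a#Γ (#E!⇒#ₜ t (lookup a#Γ t↓∈Γ)) Ft E!x[t] (hyp t↓∈Γ) a≐t
  where
  a : Par
  a = fresh (F ∷ Γ)
  a#F : a # F
  a#F = head (fresh-#* (F ∷ Γ))
  a#Γ : a #* Γ
  a#Γ = tail (fresh-#* (F ∷ Γ))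
  E!x[t] : Γ ⊢ E! (var x) [ x ≔ t ]
  E!x[t] rewrite substT-var-self x t = hyp t↓∈Γ
  Ft : Γ ⊢ F [ x ≔ t ]
  Ft = ⇔E₂ (∀E-⇔≐ t t (hyp H∈Γ) (hyp t↓∈Γ)) (=I t)
  a≐t : F [ x ≔ par a ] ∷ E! ⌜ par a ⌝ ∷ Γ ⊢ ⌜ par a ⌝ ≐ ⌜ t ⌝
  a≐t = ⇔E₁ (∀E-⇔≐ t (par a) (hyp (there (there H∈Γ))) (hyp (there (here refl)))) (hyp (here refl))

mainTheorem10 : (F : Formula) (x y : Var) → x ≢ y → varIn y F ≡ false →
                ∃' y (∀' x (F ⇔ var x ≐ var y)) ∷ [] ⊢ ι x F (E! (var x))
mainTheorem10 F x y x≢y y∉F = ∃E b b#H b#ι (b#H ∷ []) (hyp (here refl)) body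
  where
  H : Formula
  H = ∃' y (∀' x (F ⇔ var x ≐ var y))
  b : Par
  b = fresh (ι x F (E! (var x)) ∷ H ∷ [])
  b#ι : b # ι x F (E! (var x))
  b#ι = lookup (fresh-#* (ι x F (E! (var x)) ∷ H ∷ [])) (here refl)
  b#H : b # H
  b#H = lookup (fresh-#* (ι x F (E! (var x)) ∷ H ∷ [])) (there (here refl))
  body : (∀' x (F ⇔ var x ≐ var y)) [ y ≔ par b ] ∷ E! ⌜ par b ⌝ ∷ H ∷ [] ⊢ ι x F (E! (var x))
  body rewrite [≔]-∀⇔≐ F (par b) x≢y y∉F = uniqueWitness⇒ι (par b) (here refl) (there (here refl))
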